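{- $\ker \epsilon = \im \delta_1$, where $\epsilon : {\mathcal U}_{\mathbf C} \Sigma \to \Omega_{\mathbf C}^1$ is given by $\epsilon(\langle c_i\rangle) = d\tilde c_i$ and $\delta_1 : {\mathcal U}_{\mathbf C}E\to{\mathcal U}_{\mathbf C}\Sigma$ is given by $\delta_1(\langle \Gamma \vdash l \approx r\rangle) = \varphi_0(\Gamma \mid_\emptyset l) - \varphi_0(\Gamma \mid_\emptyset r)$ with $\varphi_0(\tau) = \sum_{i=1}^n \partial_{\square_i}(\mathrm{op}(\tau))_{(\tilde c_1,\dots,\tilde c_n)}\langle c_i\rangle$.
   Context: ${\mathbf C}=\mathrm{Cl}(\Sigma,E)$ is the CCC presented by a signature $\Sigma=\{c_1:T_{c_1}\to T'_{c_1},\dots,c_n:T_{c_n}\to T'_{c_n}\}$ ($T'_{c_i}$ base types) and an equation system $E$ of equations-in-context $x:T\vdash l\approx r$ (contexts of length one, free-variable multisets of $l$ and $r$ equal); $\tilde c_i=(x:T_{c_i}\mid_E c_i\,x)$. ${\mathcal U}_{\mathbf C}$ is the enveloping ringoid (objects: morphisms of ${\mathbf C}$; generated over ${\mathbb Q}$ by $\partial_{\square_i}(\omega)_{(f_1,\dots,f_n)}:f_i\to\omega\cdot(f_1,\dots,f_n)$ for CCC operations $\omega$, subject to the chain rule and $\partial_{\square_j}(\iota_i)=\delta_{ij}\mathrm{id}$). A CCC operation is a strict cartesian closed functor $\mathrm{Cl}(\{T\to T'\})\to\mathrm{Cl}(\{\square_1,\dots,\square_n\})$ between free CCCs determined by the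 image of the generator; $\mathrm{op}(\tau)$ denotes the CCC operation determined by a morphism $\tau$ of the free CCC $\mathrm{Cl}(\Sigma)$ (with the symbols $c_i$ playing the role of $\square_i$). $\Omega^1_{\mathbf C}$ is the ${\mathcal U}_{\mathbf C}$-module generated by $df$ ($f$ a morphism) with relations $d(\omega\cdot(f_1,\dots,f_m))=\sum_i\partial_{\square_i}(\omega)_{(f)}df_i$. ${\mathcal U}_{\mathbf C}\Sigma$, ${\mathcal U}_{\mathbf C}E$ are free ${\mathcal U}_{\mathbf C}$-modules, $\Sigma$ and $E$ viewed as families indexed by morphisms ($c_i\mapsto\tilde c_i$, $(\Gamma\vdash l\approx r)\mapsto(\Gamma\mid_E l)$). -}

module Defs where

open import Data.Nat using (ℕ; zero; suc) renaming (_+_ to _+ℕ_)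
open import Data.Nat using (_≡ᵇ_)
open import Data.Bool using (if_then_else_)
open import Data.Fin using (Fin; zero; suc)
open import Data.List using (List; []; _∷_; length; lookup; map)
open import Data.Product using (Σ; Σ-syntax; _×_; _,_; proj₁; proj₂)
open import Data.Rational using (ℚ; 0ℚ; 1ℚ; -_) renaming (_+_ to _+ℚ_; _*_ to _*ℚ_)
open import Relation.Binary.PropositionalEquality using (_≡_)
open import Relation.Nullary using (¬_)

-- Simple types over a set S of base types (objects of the free CCCs)

data Ty (S : Set) : Set where
  base : S → Ty S
  𝟙    : Ty S
  _⊗_  : Ty S → Ty S → Ty S
  _⇒_  : Ty S → Ty S → Ty S

module _ {S : Set} where

  Ctx : Set
  Ctx = List (Ty S)

  data _∋_ : Ctx → Ty S → Set where
    here  : ∀ {Γ A} → (A ∷ Γ) ∋ A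
    there : ∀ {Γ A B} → Γ ∋ A → (B ∷ Γ) ∋ A

  pos : ∀ {Γ A} → Γ ∋ A → ℕ
  pos here      = zero
  pos (there x) = suc (pos x)

  Sig : Set
  Sig = List (Ty S × Ty S)

  dom : (sg : Sig) → Fin (length sg) → Ty S
  dom sg i = proj₁ (lookup sg i)

  cod : (sg : Sig) → Fin (length sg) → Ty S
  cod sg i = proj₂ (lookup sg i)

  sigOf : List (Ty S × S) → Sig
  sigOf = map (λ p → (proj₁ p , base (proj₂ p)))

  data Tm (sg : Sig) (Γ : Ctx) : Ty S → Set where
    var  : ∀ {A} → Γ ∋ A → Tm sg Γ A
    unit : Tm sg Γ 𝟙
    pair : ∀ {A B} → Tm sg Γ A → Tm sg Γ B → Tm sg Γ (A ⊗ B)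
    fst  : ∀ {A B} → Tm sg Γ (A ⊗ B) → Tm sg Γ A
    snd  : ∀ {A B} → Tm sg Γ (A ⊗ B) → Tm sg Γ B
    lam  : ∀ {A B} → Tm sg (A ∷ Γ) B → Tm sg Γ (A ⇒ B)
    app  : ∀ {A B} → Tm sg Γ (A ⇒ B) → Tm sg Γ A → Tm sg Γ B
    con  : (i : Fin (length sg)) → Tm sg Γ (dom sg i) → Tm sg Γ (cod sg i)

  Ren : Ctx → Ctx → Set
  Ren Γ Δ = ∀ {A} → Γ ∋ A → Δ ∋ A

  ext : ∀ {Γ Δ B} → Ren Γ Δ → Ren (B ∷ Γ) (B ∷ Δ)
  ext ρ here      = here
  ext ρ (there x) = there (ρ x)

  ren : ∀ {sg Γ Δ A} → Ren Γ Δ → Tm sg Γ A → Tm sg Δ A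
  ren ρ (var x)    = var (ρ x)
  ren ρ unit       = unit
  ren ρ (pair t u) = pair (ren ρ t) (ren ρ u)
  ren ρ (fst t)    = fst (ren ρ t)
  ren ρ (snd t)    = snd (ren ρ t)
  ren ρ (lam t)    = lam (ren (ext ρ) t)
  ren ρ (app t u)  = app (ren ρ t) (ren ρ u)
  ren ρ (con i t)  = con i (ren ρ t)

  Sub : Sig → Ctx → Ctx → Set
  Sub sg Γ Δ = ∀ {A} → Γ ∋ A → Tm sg Δ A

  exts : ∀ {sg Γ Δ B} → Sub sg Γ Δ → Sub sg (B ∷ Γ) (B ∷ Δ)
  exts σ here      = var here
  exts σ (there x) = ren there (σ x)

  sub : ∀ {sg Γ Δ A} → Sub sg Γ Δ → Tm sg Γ A → Tm sg Δ A
  sub σ (var x)    = σ x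
  sub σ unit       = unit
  sub σ (pair t u) = pair (sub σ t) (sub σ u)
  sub σ (fst t)    = fst (sub σ t)
  sub σ (snd t)    = snd (sub σ t)
  sub σ (lam t)    = lam (sub (exts σ) t)
  sub σ (app t u)  = app (sub σ t) (sub σ u)
  sub σ (con i t)  = con i (sub σ t)

  single : ∀ {sg Γ A} → Tm sg Γ A → Sub sg (A ∷ Γ) Γ
  single u here      = u
  single u (there x) = var x

  single₀ : ∀ {sg Γ A} → Tm sg Γ A → Sub sg (A ∷ []) Γ
  single₀ u here = u

  occ : ∀ {sg Γ A} → Tm sg Γ A → ℕ → ℕ
  occ (var x)    k = if pos x ≡ᵇ k then 1 else 0
  occ unit       k = 0
  occ (pair t u) k = occ t k +ℕ occ u k
  occ (fst t)    k = occ t k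
  occ (snd t)    k = occ t k
  occ (lam t)    k = occ t (suc k)
  occ (app t u)  k = occ t k +ℕ occ u k
  occ (con i t)  k = occ t k

  -- Interpretation of the symbols of sg by one-variable terms over sg'
  -- (the action of the strict CC functor determined by the images
  -- of the generators)

  Inst : Sig → Sig → Set
  Inst sg sg' = (i : Fin (length sg)) → Tm sg' (dom sg i ∷ []) (cod sg i)

  inst : ∀ {sg sg' Γ A} → Inst sg sg' → Tm sg Γ A → Tm sg' Γ A
  inst f (var x)    = var x
  inst f unit       = unit
  inst f (pair t u) = pair (inst f t) (inst f u)
  inst f (fst t)    = fst (inst f t)
  inst f (snd t)    = snd (inst f t)
  inst f (lam t)    = lam (inst f t)
  inst f (app t u)  = app (inst f t) (inst f u)
  inst f (con i t)  = sub (single₀ (inst f t)) (f i)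

  record Equation (sg : Sig) : Set where
    constructor _⊢_≈_
    field
      {eA eB} : Ty S
      lhs rhs : Tm sg (eA ∷ []) eB
  open Equation public

  infix 4 _≈[_]_
  data _≈[_]_ {sg : Sig} : ∀ {Γ A} → Tm sg Γ A → List (Equation sg) → Tm sg Γ A → Set where
    ≈refl  : ∀ {E Γ A} {t : Tm sg Γ A} → t ≈[ E ] t
    ≈sym   : ∀ {E Γ A} {t u : Tm sg Γ A} → t ≈[ E ] u → u ≈[ E ] t
    ≈trans : ∀ {E Γ A} {t u v : Tm sg Γ A} → t ≈[ E ] u → u ≈[ E ] v → t ≈[ E ] v
    ≈pair  : ∀ {E Γ A B} {t t' : Tm sg Γ A} {u u' : Tm sg Γ B} →
             t ≈[ E ] t' → u ≈[ E ] u' → pair t u ≈[ E ] pair t' u'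
    ≈fst   : ∀ {E Γ A B} {t t' : Tm sg Γ (A ⊗ B)} → t ≈[ E ] t' → fst t ≈[ E ] fst t'
    ≈snd   : ∀ {E Γ A B} {t t' : Tm sg Γ (A ⊗ B)} → t ≈[ E ] t' → snd t ≈[ E ] snd t'
    ≈lam   : ∀ {E Γ A B} {t t' : Tm sg (A ∷ Γ) B} → t ≈[ E ] t' → lam t ≈[ E ] lam t'
    ≈app   : ∀ {E Γ A B} {t t' : Tm sg Γ (A ⇒ B)} {u u' : Tm sg Γ A} →
             t ≈[ E ] t' → u ≈[ E ] u' → app t u ≈[ E ] app t' u'
    ≈con   : ∀ {E Γ} (i : Fin (length sg)) {t t' : Tm sg Γ (dom sg i)} →
             t ≈[ E ] t' → con i t ≈[ E ] con i t'
    β-fst  : ∀ {E Γ A B} {t : Tm sg Γ A} {u : Tm sg Γ B} → fst (pair t u) ≈[ E ] t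
    β-snd  : ∀ {E Γ A B} {t : Tm sg Γ A} {u : Tm sg Γ B} → snd (pair t u) ≈[ E ] u
    η-pair : ∀ {E Γ A B} {t : Tm sg Γ (A ⊗ B)} → pair (fst t) (snd t) ≈[ E ] t
    η-unit : ∀ {E Γ} {t : Tm sg Γ 𝟙} → t ≈[ E ] unit
    β-lam  : ∀ {E Γ A B} {t : Tm sg (A ∷ Γ) B} {u : Tm sg Γ A} →
             app (lam t) u ≈[ E ] sub (single u) t
    η-lam  : ∀ {E Γ A B} {t : Tm sg Γ (A ⇒ B)} →
             lam (app (ren there t) (var here)) ≈[ E ] t
    ax     : ∀ {E} (e : Fin (length E)) → lhs (lookup E e) ≈[ E ] rhs (lookup E e)
    ≈sub   : ∀ {E Γ Δ A} {σ σ' : Sub sg Γ Δ} {t t' : Tm sg Γ A} →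
             (∀ {B} (x : Γ ∋ B) → σ x ≈[ E ] σ' x) → t ≈[ E ] t' → sub σ t ≈[ E ] sub σ' t'

  -- CCC operations  Cl({oA → oB}) → Cl(ar), determined by the image
  -- of the generator

  record Op : Set where
    constructor mkOp
    field
      ar     : Sig
      oA oB  : Ty S
      body   : Tm ar (oA ∷ []) oB
  open Op public

  ιop : (sg : Sig) → Fin (length sg) → Op
  ιop sg i = mkOp sg (dom sg i) (cod sg i) (con i (var here))

  -- Everything below is relative to the CCC  C = Cl(Σ , E)

  module _ (Sg : Sig) (E : List (Equation Sg)) where

    -- objects of the ringoid: morphisms of C
    Obj : Set
    Obj = Σ[ AB ∈ Ty S × Ty S ] Tm Sg (proj₁ AB ∷ []) (proj₂ AB)

    obj : ∀ {A B} → Tm Sg (A ∷ []) B → Obj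
    obj {A} {B} t = ((A , B) , t)

    data ObjEq : Obj → Obj → Set where
      mk : ∀ {A B} {t t' : Tm Sg (A ∷ []) B} → t ≈[ E ] t' → ObjEq (obj t) (obj t')

    Args : Sig → Set
    Args sg = Inst sg Sg

    apply : (ω : Op) → Args (ar ω) → Tm Sg (oA ω ∷ []) (oB ω)
    apply ω f = inst f (body ω)

    -- raw morphisms of the enveloping ringoid U_C
    infixr 9 _∘U_
    infixl 6 _+U_
    infixr 7 _•U_
    data UExp : Obj → Obj → Set where
      gen   : (ω : Op) (i : Fin (length (ar ω))) (f : Args (ar ω)) →
              UExp (obj (f i)) (obj (apply ω f))
      cast  : ∀ {a b} → ObjEq a b → UExp a b
      idU   : ∀ {a} → UExp a a
      _∘U_  : ∀ {a b c} → UExp b c → UExp a b → UExp a c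
      zeroU : ∀ {a b} → UExp a b
      _+U_  : ∀ {a b} → UExp a b → UExp a b → UExp a b
      _•U_  : ∀ {a b} → ℚ → UExp a b → UExp a b

    sumU : ∀ {m a b} → (Fin m → UExp a b) → UExp a b
    sumU {zero}  u = zeroU
    sumU {suc m} u = u zero +U sumU (λ j → u (suc j))

    -- equality of morphisms of U_C : the ℚ-linear category generated,
    -- with objects identified along equality in C, subject to the
    -- chain rule and  ∂_{□_j}(ι_i) = δ_ij id
    infix 4 _≈U_
    data _≈U_ : ∀ {a b} → UExp a b → UExp a b → Set where
      ≈Urefl  : ∀ {a b} {u : UExp a b} → u ≈U u
      ≈Usym   : ∀ {a b} {u v : UExp a b} → u ≈U v → v ≈U u
      ≈Utrans : ∀ {a b} {u v w : UExp a b} → u ≈U v → v ≈U w → u ≈U w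
      ∘-cong  : ∀ {a b c} {u u' : UExp b c} {v v' : UExp a b} →
                u ≈U u' → v ≈U v' → u ∘U v ≈U u' ∘U v'
      +-cong  : ∀ {a b} {u u' v v' : UExp a b} → u ≈U u' → v ≈U v' → u +U v ≈U u' +U v'
      •-cong  : ∀ {a b} (q : ℚ) {u u' : UExp a b} → u ≈U u' → q •U u ≈U q •U u'
      idˡ     : ∀ {a b} {u : UExp a b} → idU ∘U u ≈U u
      idʳ     : ∀ {a b} {u : UExp a b} → u ∘U idU ≈U u
      ∘-assoc : ∀ {a b c d} {u : UExp c d} {v : UExp b c} {w : UExp a b} →
                (u ∘U v) ∘U w ≈U u ∘U (v ∘U w)
      +-assoc : ∀ {a b} {u v w : UExp a b} → (u +U v) +U w ≈U u +U (v +U w)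
      +-comm  : ∀ {a b} {u v : UExp a b} → u +U v ≈U v +U u
      +-idˡ   : ∀ {a b} {u : UExp a b} → zeroU +U u ≈U u
      •-one   : ∀ {a b} {u : UExp a b} → 1ℚ •U u ≈U u
      •-zero  : ∀ {a b} {u : UExp a b} → 0ℚ •U u ≈U zeroU
      •-assoc : ∀ {a b} (p q : ℚ) {u : UExp a b} → p •U (q •U u) ≈U (p *ℚ q) •U u
      •-distʳ : ∀ {a b} (p q : ℚ) {u : UExp a b} → (p +ℚ q) •U u ≈U p •U u +U q •U u
      •-distˡ : ∀ {a b} (p : ℚ) {u v : UExp a b} → p •U (u +U v) ≈U p •U u +U p •U v
      ∘-distʳ : ∀ {a b c} {u v : UExp b c} {w : UExp a b} → (u +U v) ∘U w ≈U u ∘U w +U v ∘U w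
      ∘-distˡ : ∀ {a b c} {u : UExp b c} {v w : UExp a b} → u ∘U (v +U w) ≈U u ∘U v +U u ∘U w
      ∘-•ˡ    : ∀ {a b c} (q : ℚ) {u : UExp b c} {v : UExp a b} → (q •U u) ∘U v ≈U q •U (u ∘U v)
      ∘-•ʳ    : ∀ {a b c} (q : ℚ) {u : UExp b c} {v : UExp a b} → u ∘U (q •U v) ≈U q •U (u ∘U v)
      cast-id  : ∀ {a} (p : ObjEq a a) → cast p ≈U idU
      cast-∘   : ∀ {a b c} (p : ObjEq a b) (q : ObjEq b c) (r : ObjEq a c) →
                 cast q ∘U cast p ≈U cast r
      gen-resp : ∀ {sg A B} (t t' : Tm sg (A ∷ []) B) → t ≈[ [] ] t' →
                 (f f' : Args sg) → (∀ j → f j ≈[ E ] f' j) → (i : Fin (length sg)) →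
                 (p : ObjEq (obj (f i)) (obj (f' i))) →
                 (q : ObjEq (obj (inst f t)) (obj (inst f' t'))) →
                 cast q ∘U gen (mkOp sg A B t) i f ≈U gen (mkOp sg A B t') i f' ∘U cast p
      ι-diag   : ∀ (sg : Sig) (i : Fin (length sg)) (f : Args sg)
                 (p : ObjEq (obj (f i)) (obj (apply (ιop sg i) f))) →
                 gen (ιop sg i) i f ≈U cast p
      ι-off    : ∀ (sg : Sig) (i j : Fin (length sg)) (f : Args sg) → ¬ (i ≡ j) →
                 gen (ιop sg i) j f ≈U zeroU
      chain    : ∀ (ω : Op) (sg : Sig) (ωs : Inst (ar ω) sg) (f : Args sg)
                 (i : Fin (length sg))
                 (p : ObjEq (obj (apply ω (λ j → inst f (ωs j))))
                            (obj (inst f (inst ωs (body ω))))) →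
                 gen (mkOp sg (oA ω) (oB ω) (inst ωs (body ω))) i f
                   ≈U cast p ∘U sumU (λ j → gen ω j (λ j' → inst f (ωs j'))
                                            ∘U gen (mkOp sg _ _ (ωs j)) i f)

    -- raw elements of the module Ω¹_C
    infixl 6 _+Ω_
    data ΩExp : Obj → Set where
      dΩ    : (a : Obj) → ΩExp a
      actΩ  : ∀ {a b} → UExp a b → ΩExp a → ΩExp b
      zeroΩ : ∀ {a} → ΩExp a
      _+Ω_  : ∀ {a} → ΩExp a → ΩExp a → ΩExp a

    sumΩ : ∀ {m a} → (Fin m → ΩExp a) → ΩExp a
    sumΩ {zero}  x = zeroΩ
    sumΩ {suc m} x = x zero +Ω sumΩ (λ j → x (suc j))

    infix 4 _≈Ω_
    data _≈Ω_ : ∀ {a} → ΩExp a → ΩExp a → Set where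
      ≈Ωrefl  : ∀ {a} {x : ΩExp a} → x ≈Ω x
      ≈Ωsym   : ∀ {a} {x y : ΩExp a} → x ≈Ω y → y ≈Ω x
      ≈Ωtrans : ∀ {a} {x y z : ΩExp a} → x ≈Ω y → y ≈Ω z → x ≈Ω z
      act-cong : ∀ {a b} {u u' : UExp a b} {x x' : ΩExp a} →
                 u ≈U u' → x ≈Ω x' → actΩ u x ≈Ω actΩ u' x'
      +Ω-cong : ∀ {a} {x x' y y' : ΩExp a} → x ≈Ω x' → y ≈Ω y' → x +Ω y ≈Ω x' +Ω y'
      +Ω-assoc : ∀ {a} {x y z : ΩExp a} → (x +Ω y) +Ω z ≈Ω x +Ω (y +Ω z)
      +Ω-comm  : ∀ {a} {x y : ΩExp a} → x +Ω y ≈Ω y +Ω x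
      +Ω-idˡ   : ∀ {a} {x : ΩExp a} → zeroΩ +Ω x ≈Ω x
      act-id   : ∀ {a} {x : ΩExp a} → actΩ idU x ≈Ω x
      act-∘    : ∀ {a b c} {u : UExp b c} {v : UExp a b} {x : ΩExp a} →
                 actΩ (u ∘U v) x ≈Ω actΩ u (actΩ v x)
      act-+U   : ∀ {a b} {u v : UExp a b} {x : ΩExp a} →
                 actΩ (u +U v) x ≈Ω actΩ u x +Ω actΩ v x
      act-zeroU : ∀ {a b} {x : ΩExp a} → actΩ (zeroU {a} {b}) x ≈Ω zeroΩ
      act-+Ω   : ∀ {a b} {u : UExp a b} {x y : ΩExp a} →
                 actΩ u (x +Ω y) ≈Ω actΩ u x +Ω actΩ u y
      act-zeroΩ : ∀ {a b} {u : UExp a b} → actΩ u zeroΩ ≈Ω zeroΩ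
      d-cast   : ∀ {a b} (p : ObjEq a b) → dΩ b ≈Ω actΩ (cast p) (dΩ a)
      d-op     : ∀ (ω : Op) (f : Args (ar ω)) →
                 dΩ (obj (apply ω f)) ≈Ω sumΩ (λ i → actΩ (gen ω i f) (dΩ (obj (f i))))

    c̃ : Args Sg
    c̃ i = con i (var here)

    c̃obj : Fin (length Sg) → Obj
    c̃obj i = obj (c̃ i)

    op : ∀ {A B} → Tm Sg (A ∷ []) B → Op
    op {A} {B} t = mkOp Sg A B t

    -- the free modules U_C Σ and U_C E, elements at object b
    UΣ : Obj → Set
    UΣ b = (i : Fin (length Sg)) → UExp (c̃obj i) b

    eobj : Fin (length E) → Obj
    eobj e = obj (lhs (lookup E e))

    UE : Obj → Set
    UE b = (e : Fin (length E)) → UExp (eobj e) b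

    infix 4 _≈UΣ_
    _≈UΣ_ : ∀ {b} → UΣ b → UΣ b → Set
    x ≈UΣ y = ∀ i → x i ≈U y i

    inst-c̃ : ∀ {Γ A} (t : Tm Sg Γ A) → inst c̃ t ≈[ E ] t
    inst-c̃ (var x)    = ≈refl
    inst-c̃ unit       = ≈refl
    inst-c̃ (pair t u) = ≈pair (inst-c̃ t) (inst-c̃ u)
    inst-c̃ (fst t)    = ≈fst (inst-c̃ t)
    inst-c̃ (snd t)    = ≈snd (inst-c̃ t)
    inst-c̃ (lam t)    = ≈lam (inst-c̃ t)
    inst-c̃ (app t u)  = ≈app (inst-c̃ t) (inst-c̃ u)
    inst-c̃ (con i t)  = ≈con i (inst-c̃ t)

    φ₀ : ∀ {A B} (t : Tm Sg (A ∷ []) B) → UΣ (obj t)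
    φ₀ t i = cast (mk (inst-c̃ t)) ∘U gen (op t) i c̃

    ε : ∀ {b} → UΣ b → ΩExp b
    ε x = sumΩ (λ i → actΩ (x i) (dΩ (c̃obj i)))

    δ₁gen : (e : Fin (length E)) → UΣ (eobj e)
    δ₁gen e i = φ₀ (lhs (lookup E e)) i
                +U (Data.Rational.- 1ℚ) •U (cast (mk (≈sym (ax e))) ∘U φ₀ (rhs (lookup E e)) i)

    δ₁ : ∀ {b} → UE b → UΣ b
    δ₁ y i = sumU (λ e → y e ∘U δ₁gen e i)

{-# OPTIONS --safe #-}

-- ε ∘ δ₁ = 0: by the chain rule ε (φ₀ τ) = dτ, so ε sends the generator ⟨l ≈ r⟩ to dl − dr = 0.
-- Conversely, let φ : Ω¹ → U_C Σ send dτ to φ₀ τ. Modulo im δ₁ it respects the defining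
-- relations of Ω¹: the chain-rule relation holds on the nose, and an equality τ = τ' in C is a
-- chain of βη-steps, which φ₀ respects, and of rewrites T[l] ⇝ T[r], for which the chain rule
-- for op T reduces φ₀ T[r] − φ₀ T[l] to a multiple of δ₁ ⟨l ≈ r⟩. Since ∂_{□ⱼ}(ιᵢ) = δᵢⱼ we have
-- φ (ε x) = x, so ε x = 0 forces x ≡ φ 0 = 0 modulo im δ₁.
module Submission where

open import Defs
open import Data.List using (List; _∷_; []; length; lookup)
open import Data.Product using (_×_; ∃; _,_)
open import Data.Fin using (Fin; zero; suc)
open import Data.Nat using (ℕ; zero; suc)
open import Data.Rational using (1ℚ; 0ℚ; -_) renaming (_+_ to _+ℚ_)
open import Level using (0ℓ)
open import Algebra.Bundles using (AbelianGroup; CommutativeMonoid)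
import Algebra.Properties.AbelianGroup as AbelianGroupProperties
import Algebra.Properties.CommutativeSemigroup as CommutativeSemigroupProperties
import Relation.Binary.Reasoning.Setoid as SetoidReasoning
open import Relation.Binary.PropositionalEquality using (_≡_; _≢_; refl; cong; cong₂; trans; sym; subst; subst₂)
open import Function.Bundles using (_⇔_; mk⇔)

module Syntax {S : Set} where
  private variable
    sg sg' : Sig {S}
    Γ Δ Θ : Ctx {S}
    A : Ty S

  ren-cong : {ρ ρ' : Ren Γ Δ} → (∀ {B} (x : Γ ∋ B) → ρ x ≡ ρ' x) →
             (t : Tm sg Γ A) → ren ρ t ≡ ren ρ' t
  ren-cong h (var x)    = cong var (h x)
  ren-cong h unit       = refl
  ren-cong h (pair t u) = cong₂ pair (ren-cong h t) (ren-cong h u)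
  ren-cong h (fst t)    = cong fst (ren-cong h t)
  ren-cong h (snd t)    = cong snd (ren-cong h t)
  ren-cong h (lam t)    = cong lam (ren-cong (λ { here → refl ; (there x) → cong there (h x) }) t)
  ren-cong h (app t u)  = cong₂ app (ren-cong h t) (ren-cong h u)
  ren-cong h (con i t)  = cong (con i) (ren-cong h t)

  sub-cong : {σ σ' : Sub sg Γ Δ} → (∀ {B} (x : Γ ∋ B) → σ x ≡ σ' x) →
             (t : Tm sg Γ A) → sub σ t ≡ sub σ' t
  sub-cong h (var x)    = h x
  sub-cong h unit       = refl
  sub-cong h (pair t u) = cong₂ pair (sub-cong h t) (sub-cong h u)
  sub-cong h (fst t)    = cong fst (sub-cong h t)
  sub-cong h (snd t)    = cong snd (sub-cong h t)
  sub-cong h (lam t)    = cong lam (sub-cong (λ { here → refl ; (there x) → cong (ren there) (h x) }) t)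
  sub-cong h (app t u)  = cong₂ app (sub-cong h t) (sub-cong h u)
  sub-cong h (con i t)  = cong (con i) (sub-cong h t)

  ren-ren : (ρ : Ren Δ Θ) (ρ' : Ren Γ Δ) (t : Tm sg Γ A) →
            ren ρ (ren ρ' t) ≡ ren (λ x → ρ (ρ' x)) t
  ren-ren ρ ρ' (var x)    = refl
  ren-ren ρ ρ' unit       = refl
  ren-ren ρ ρ' (pair t u) = cong₂ pair (ren-ren ρ ρ' t) (ren-ren ρ ρ' u)
  ren-ren ρ ρ' (fst t)    = cong fst (ren-ren ρ ρ' t)
  ren-ren ρ ρ' (snd t)    = cong snd (ren-ren ρ ρ' t)
  ren-ren ρ ρ' (lam t)    =
    cong lam (trans (ren-ren (ext ρ) (ext ρ') t) (ren-cong (λ { here → refl ; (there x) → refl }) t))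
  ren-ren ρ ρ' (app t u)  = cong₂ app (ren-ren ρ ρ' t) (ren-ren ρ ρ' u)
  ren-ren ρ ρ' (con i t)  = cong (con i) (ren-ren ρ ρ' t)

  sub-ren : (σ : Sub sg Δ Θ) (ρ : Ren Γ Δ) (t : Tm sg Γ A) →
            sub σ (ren ρ t) ≡ sub (λ x → σ (ρ x)) t
  sub-ren σ ρ (var x)    = refl
  sub-ren σ ρ unit       = refl
  sub-ren σ ρ (pair t u) = cong₂ pair (sub-ren σ ρ t) (sub-ren σ ρ u)
  sub-ren σ ρ (fst t)    = cong fst (sub-ren σ ρ t)
  sub-ren σ ρ (snd t)    = cong snd (sub-ren σ ρ t)
  sub-ren σ ρ (lam t)    =
    cong lam (trans (sub-ren (exts σ) (ext ρ) t) (sub-cong (λ { here → refl ; (there x) → refl }) t))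
  sub-ren σ ρ (app t u)  = cong₂ app (sub-ren σ ρ t) (sub-ren σ ρ u)
  sub-ren σ ρ (con i t)  = cong (con i) (sub-ren σ ρ t)

  ren-sub : (ρ : Ren Δ Θ) (σ : Sub sg Γ Δ) (t : Tm sg Γ A) →
            ren ρ (sub σ t) ≡ sub (λ x → ren ρ (σ x)) t
  ren-sub ρ σ (var x)    = refl
  ren-sub ρ σ unit       = refl
  ren-sub ρ σ (pair t u) = cong₂ pair (ren-sub ρ σ t) (ren-sub ρ σ u)
  ren-sub ρ σ (fst t)    = cong fst (ren-sub ρ σ t)
  ren-sub ρ σ (snd t)    = cong snd (ren-sub ρ σ t)
  ren-sub ρ σ (lam t)    = cong lam (trans (ren-sub (ext ρ) (exts σ) t) (sub-cong h t))
    where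
    h : ∀ {B} (x : _ ∋ B) → ren (ext ρ) (exts σ x) ≡ exts (λ y → ren ρ (σ y)) x
    h here      = refl
    h (there x) = trans (ren-ren (ext ρ) there (σ x)) (sym (ren-ren there ρ (σ x)))
  ren-sub ρ σ (app t u)  = cong₂ app (ren-sub ρ σ t) (ren-sub ρ σ u)
  ren-sub ρ σ (con i t)  = cong (con i) (ren-sub ρ σ t)

  sub-sub : (σ : Sub sg Δ Θ) (τ : Sub sg Γ Δ) (t : Tm sg Γ A) →
            sub σ (sub τ t) ≡ sub (λ x → sub σ (τ x)) t
  sub-sub σ τ (var x)    = refl
  sub-sub σ τ unit       = refl
  sub-sub σ τ (pair t u) = cong₂ pair (sub-sub σ τ t) (sub-sub σ τ u)
  sub-sub σ τ (fst t)    = cong fst (sub-sub σ τ t)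
  sub-sub σ τ (snd t)    = cong snd (sub-sub σ τ t)
  sub-sub σ τ (lam t)    = cong lam (trans (sub-sub (exts σ) (exts τ) t) (sub-cong h t))
    where
    h : ∀ {B} (x : _ ∋ B) → sub (exts σ) (exts τ x) ≡ exts (λ y → sub σ (τ y)) x
    h here      = refl
    h (there x) = trans (sub-ren (exts σ) there (τ x)) (sym (ren-sub there σ (τ x)))
  sub-sub σ τ (app t u)  = cong₂ app (sub-sub σ τ t) (sub-sub σ τ u)
  sub-sub σ τ (con i t)  = cong (con i) (sub-sub σ τ t)

  sub-id : {σ : Sub sg Γ Γ} → (∀ {B} (x : Γ ∋ B) → σ x ≡ var x) → (t : Tm sg Γ A) → sub σ t ≡ t
  sub-id h (var x)    = h x
  sub-id h unit       = refl
  sub-id h (pair t u) = cong₂ pair (sub-id h t) (sub-id h u)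
  sub-id h (fst t)    = cong fst (sub-id h t)
  sub-id h (snd t)    = cong snd (sub-id h t)
  sub-id h (lam t)    = cong lam (sub-id (λ { here → refl ; (there x) → cong (ren there) (h x) }) t)
  sub-id h (app t u)  = cong₂ app (sub-id h t) (sub-id h u)
  sub-id h (con i t)  = cong (con i) (sub-id h t)

  ren≡sub-var : (ρ : Ren Γ Δ) (t : Tm sg Γ A) → ren ρ t ≡ sub (λ x → var (ρ x)) t
  ren≡sub-var ρ (var x)    = refl
  ren≡sub-var ρ unit       = refl
  ren≡sub-var ρ (pair t u) = cong₂ pair (ren≡sub-var ρ t) (ren≡sub-var ρ u)
  ren≡sub-var ρ (fst t)    = cong fst (ren≡sub-var ρ t)
  ren≡sub-var ρ (snd t)    = cong snd (ren≡sub-var ρ t)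
  ren≡sub-var ρ (lam t)    =
    cong lam (trans (ren≡sub-var (ext ρ) t) (sub-cong (λ { here → refl ; (there x) → refl }) t))
  ren≡sub-var ρ (app t u)  = cong₂ app (ren≡sub-var ρ t) (ren≡sub-var ρ u)
  ren≡sub-var ρ (con i t)  = cong (con i) (ren≡sub-var ρ t)

  inst-ren : (f : Inst sg sg') (ρ : Ren Γ Δ) (t : Tm sg Γ A) → inst f (ren ρ t) ≡ ren ρ (inst f t)
  inst-ren f ρ (var x)    = refl
  inst-ren f ρ unit       = refl
  inst-ren f ρ (pair t u) = cong₂ pair (inst-ren f ρ t) (inst-ren f ρ u)
  inst-ren f ρ (fst t)    = cong fst (inst-ren f ρ t)
  inst-ren f ρ (snd t)    = cong snd (inst-ren f ρ t)
  inst-ren f ρ (lam t)    = cong lam (inst-ren f (ext ρ) t)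
  inst-ren f ρ (app t u)  = cong₂ app (inst-ren f ρ t) (inst-ren f ρ u)
  inst-ren f ρ (con i t)  =
    trans (cong (λ s → sub (single₀ s) (f i)) (inst-ren f ρ t))
          (trans (sub-cong (λ { here → refl }) (f i)) (sym (ren-sub ρ (single₀ (inst f t)) (f i))))

  inst-sub : (f : Inst sg sg') (σ : Sub sg Γ Δ) (t : Tm sg Γ A) →
             inst f (sub σ t) ≡ sub (λ x → inst f (σ x)) (inst f t)
  inst-sub f σ (var x)    = refl
  inst-sub f σ unit       = refl
  inst-sub f σ (pair t u) = cong₂ pair (inst-sub f σ t) (inst-sub f σ u)
  inst-sub f σ (fst t)    = cong fst (inst-sub f σ t)
  inst-sub f σ (snd t)    = cong snd (inst-sub f σ t)
  inst-sub f σ (lam t)    =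
    cong lam (trans (inst-sub f (exts σ) t)
                    (sub-cong (λ { here → refl ; (there x) → inst-ren f there (σ x) }) (inst f t)))
  inst-sub f σ (app t u)  = cong₂ app (inst-sub f σ t) (inst-sub f σ u)
  inst-sub f σ (con i t)  =
    trans (cong (λ s → sub (single₀ s) (f i)) (inst-sub f σ t))
          (trans (sub-cong (λ { here → refl }) (f i))
                 (sym (sub-sub (λ x → inst f (σ x)) (single₀ (inst f t)) (f i))))

module _ {S : Set} {sg : Sig {S}} where
  private variable
    Γ : Ctx {S}
    A : Ty S

  ≈-weaken : {E : List (Equation sg)} {t t' : Tm sg Γ A} → t ≈[ [] ] t' → t ≈[ E ] t'
  ≈-weaken ≈refl         = ≈refl
  ≈-weaken (≈sym p)      = ≈sym (≈-weaken p)
  ≈-weaken (≈trans p q)  = ≈trans (≈-weaken p) (≈-weaken q)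
  ≈-weaken (≈pair p q)   = ≈pair (≈-weaken p) (≈-weaken q)
  ≈-weaken (≈fst p)      = ≈fst (≈-weaken p)
  ≈-weaken (≈snd p)      = ≈snd (≈-weaken p)
  ≈-weaken (≈lam p)      = ≈lam (≈-weaken p)
  ≈-weaken (≈app p q)    = ≈app (≈-weaken p) (≈-weaken q)
  ≈-weaken (≈con i p)    = ≈con i (≈-weaken p)
  ≈-weaken β-fst         = β-fst
  ≈-weaken β-snd         = β-snd
  ≈-weaken η-pair        = η-pair
  ≈-weaken η-unit        = η-unit
  ≈-weaken β-lam         = β-lam
  ≈-weaken η-lam         = η-lam
  ≈-weaken (≈sub h p)    = ≈sub (λ x → ≈-weaken (h x)) (≈-weaken p)

  inst-cong : {sg' : Sig {S}} {E : List (Equation sg')} {f f' : Inst sg sg'} →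
              (∀ j → f j ≈[ E ] f' j) → (t : Tm sg Γ A) → inst f t ≈[ E ] inst f' t
  inst-cong h (var x)    = ≈refl
  inst-cong h unit       = ≈refl
  inst-cong h (pair t u) = ≈pair (inst-cong h t) (inst-cong h u)
  inst-cong h (fst t)    = ≈fst (inst-cong h t)
  inst-cong h (snd t)    = ≈snd (inst-cong h t)
  inst-cong h (lam t)    = ≈lam (inst-cong h t)
  inst-cong h (app t u)  = ≈app (inst-cong h t) (inst-cong h u)
  inst-cong h (con i t)  = ≈sub (λ { here → inst-cong h t }) (h i)

module Chains {S : Set} (Sg : Sig {S}) (E : List (Equation Sg)) where
  open Syntax {S}

  private variable
    Γ Δ : Ctx {S}
    A A' B : Ty S
    X : Ty S × Ty S

  eqSym : Fin (length E) → Ty S × Ty S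
  eqSym e = (eA (lookup E e) , eB (lookup E e))

  fill : Tm Sg (A ∷ []) B → Inst ((A , B) ∷ Sg) Sg
  fill u zero    = u
  fill u (suc i) = c̃ Sg E i

  weakenSig : Tm Sg Γ A → Tm (X ∷ Sg) Γ A
  weakenSig (var x)    = var x
  weakenSig unit       = unit
  weakenSig (pair t u) = pair (weakenSig t) (weakenSig u)
  weakenSig (fst t)    = fst (weakenSig t)
  weakenSig (snd t)    = snd (weakenSig t)
  weakenSig (lam t)    = lam (weakenSig t)
  weakenSig (app t u)  = app (weakenSig t) (weakenSig u)
  weakenSig (con i t)  = con (suc i) (weakenSig t)

  fill-weakenSig : (u : Tm Sg (A ∷ []) B) (t : Tm Sg Γ A') → inst (fill u) (weakenSig t) ≡ t
  fill-weakenSig u (var x)    = refl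
  fill-weakenSig u unit       = refl
  fill-weakenSig u (pair t v) = cong₂ pair (fill-weakenSig u t) (fill-weakenSig u v)
  fill-weakenSig u (fst t)    = cong fst (fill-weakenSig u t)
  fill-weakenSig u (snd t)    = cong snd (fill-weakenSig u t)
  fill-weakenSig u (lam t)    = cong lam (fill-weakenSig u t)
  fill-weakenSig u (app t v)  = cong₂ app (fill-weakenSig u t) (fill-weakenSig u v)
  fill-weakenSig u (con i t)  = cong (con i) (fill-weakenSig u t)

  -- A term T over the signature extended by a symbol for equation e is a context whose
  -- occurrences of that symbol mark where l is rewritten to r.
  data Chain {Γ A} : Tm Sg Γ A → Tm Sg Γ A → Set where
    βη      : ∀ {t t'} → t ≈[ [] ] t' → Chain t t'
    step    : (e : Fin (length E)) (T : Tm (eqSym e ∷ Sg) Γ A) →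
              Chain (inst (fill (lhs (lookup E e))) T) (inst (fill (rhs (lookup E e))) T)
    reverse : ∀ {t t'} → Chain t t' → Chain t' t
    _then_  : ∀ {t u v} → Chain t u → Chain u v → Chain t v

  Chain-map : (F : ∀ {X} → Tm (X ∷ Sg) Γ A → Tm (X ∷ Sg) Δ B) (F₀ : Tm Sg Γ A → Tm Sg Δ B) →
              (∀ {t t'} → t ≈[ [] ] t' → F₀ t ≈[ [] ] F₀ t') →
              (∀ {A' B'} (u : Tm Sg (A' ∷ []) B') T → inst (fill u) (F T) ≡ F₀ (inst (fill u) T)) →
              ∀ {t t'} → Chain t t' → Chain (F₀ t) (F₀ t')
  Chain-map F F₀ F₀-cong F-fill (βη p)       = βη (F₀-cong p)
  Chain-map F F₀ F₀-cong F-fill (step e T)   = subst₂ Chain (F-fill _ T) (F-fill _ T) (step e (F T))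
  Chain-map F F₀ F₀-cong F-fill (reverse c)  = reverse (Chain-map F F₀ F₀-cong F-fill c)
  Chain-map F F₀ F₀-cong F-fill (c then c') =
    Chain-map F F₀ F₀-cong F-fill c then Chain-map F F₀ F₀-cong F-fill c'

  Chain-pairˡ : {t t' : Tm Sg Γ A} (u : Tm Sg Γ B) → Chain t t' → Chain (pair t u) (pair t' u)
  Chain-pairˡ u = Chain-map (λ T → pair T (weakenSig u)) (λ t → pair t u) (λ p → ≈pair p ≈refl)
                            (λ v T → cong (pair _) (fill-weakenSig v u))

  Chain-pairʳ : (t : Tm Sg Γ A) {u u' : Tm Sg Γ B} → Chain u u' → Chain (pair t u) (pair t u')
  Chain-pairʳ t = Chain-map (λ T → pair (weakenSig t) T) (pair t) (≈pair ≈refl)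
                            (λ v T → cong (λ s → pair s _) (fill-weakenSig v t))

  Chain-appˡ : {t t' : Tm Sg Γ (A ⇒ B)} (u : Tm Sg Γ A) → Chain t t' → Chain (app t u) (app t' u)
  Chain-appˡ u = Chain-map (λ T → app T (weakenSig u)) (λ t → app t u) (λ p → ≈app p ≈refl)
                           (λ v T → cong (app _) (fill-weakenSig v u))

  Chain-appʳ : (t : Tm Sg Γ (A ⇒ B)) {u u' : Tm Sg Γ A} → Chain u u' → Chain (app t u) (app t u')
  Chain-appʳ t = Chain-map (λ T → app (weakenSig t) T) (app t) (≈app ≈refl)
                           (λ v T → cong (λ s → app s _) (fill-weakenSig v t))

  Chain-pair : {t t' : Tm Sg Γ A} {u u' : Tm Sg Γ B} → Chain t t' → Chain u u' →
               Chain (pair t u) (pair t' u')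
  Chain-pair {t' = t'} c d = Chain-pairˡ _ c then Chain-pairʳ t' d

  Chain-app : {t t' : Tm Sg Γ (A ⇒ B)} {u u' : Tm Sg Γ A} → Chain t t' → Chain u u' →
              Chain (app t u) (app t' u')
  Chain-app {t' = t'} c d = Chain-appˡ _ c then Chain-appʳ t' d

  Chain-fst : {t t' : Tm Sg Γ (A ⊗ B)} → Chain t t' → Chain (fst t) (fst t')
  Chain-fst = Chain-map fst fst ≈fst (λ _ _ → refl)

  Chain-snd : {t t' : Tm Sg Γ (A ⊗ B)} → Chain t t' → Chain (snd t) (snd t')
  Chain-snd = Chain-map snd snd ≈snd (λ _ _ → refl)

  Chain-lam : {t t' : Tm Sg (A ∷ Γ) B} → Chain t t' → Chain (lam t) (lam t')
  Chain-lam = Chain-map lam lam ≈lam (λ _ _ → refl)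

  Chain-con : (i : Fin (length Sg)) {t t' : Tm Sg Γ (dom Sg i)} → Chain t t' → Chain (con i t) (con i t')
  Chain-con i = Chain-map (con (suc i)) (con i) (≈con i) (λ _ _ → refl)

  Chain-sub : (σ : Sub Sg Γ Δ) {t t' : Tm Sg Γ A} → Chain t t' → Chain (sub σ t) (sub σ t')
  Chain-sub σ = Chain-map (sub (λ x → weakenSig (σ x))) (sub σ) (≈sub (λ _ → ≈refl))
    (λ v T → trans (inst-sub (fill v) (λ x → weakenSig (σ x)) T)
                   (sub-cong (λ x → fill-weakenSig v (σ x)) (inst (fill v) T)))

  Chain-ren : (ρ : Ren Γ Δ) {t t' : Tm Sg Γ A} → Chain t t' → Chain (ren ρ t) (ren ρ t')
  Chain-ren ρ {t} {t'} c =
    subst₂ Chain (sym (ren≡sub-var ρ t)) (sym (ren≡sub-var ρ t')) (Chain-sub (λ x → var (ρ x)) c)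

  Chain-subˢ : {σ σ' : Sub Sg Γ Δ} → (∀ {C} (x : Γ ∋ C) → Chain (σ x) (σ' x)) →
               (t : Tm Sg Γ A) → Chain (sub σ t) (sub σ' t)
  Chain-subˢ h (var x)    = h x
  Chain-subˢ h unit       = βη ≈refl
  Chain-subˢ h (pair t u) = Chain-pair (Chain-subˢ h t) (Chain-subˢ h u)
  Chain-subˢ h (fst t)    = Chain-fst (Chain-subˢ h t)
  Chain-subˢ h (snd t)    = Chain-snd (Chain-subˢ h t)
  Chain-subˢ h (lam t)    = Chain-lam (Chain-subˢ (λ { here → βη ≈refl ; (there x) → Chain-ren there (h x) }) t)
  Chain-subˢ h (app t u)  = Chain-app (Chain-subˢ h t) (Chain-subˢ h u)
  Chain-subˢ h (con i t)  = Chain-con i (Chain-subˢ h t)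

  ≈⇒Chain : {t t' : Tm Sg Γ A} → t ≈[ E ] t' → Chain t t'
  ≈⇒Chain ≈refl                 = βη ≈refl
  ≈⇒Chain (≈sym p)              = reverse (≈⇒Chain p)
  ≈⇒Chain (≈trans p q)          = ≈⇒Chain p then ≈⇒Chain q
  ≈⇒Chain (≈pair p q)           = Chain-pair (≈⇒Chain p) (≈⇒Chain q)
  ≈⇒Chain (≈fst p)              = Chain-fst (≈⇒Chain p)
  ≈⇒Chain (≈snd p)              = Chain-snd (≈⇒Chain p)
  ≈⇒Chain (≈lam p)              = Chain-lam (≈⇒Chain p)
  ≈⇒Chain (≈app p q)            = Chain-app (≈⇒Chain p) (≈⇒Chain q)
  ≈⇒Chain (≈con i p)            = Chain-con i (≈⇒Chain p)
  ≈⇒Chain β-fst                 = βη β-fst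
  ≈⇒Chain β-snd                 = βη β-snd
  ≈⇒Chain η-pair                = βη η-pair
  ≈⇒Chain η-unit                = βη η-unit
  ≈⇒Chain β-lam                 = βη β-lam
  ≈⇒Chain η-lam                 = βη η-lam
  ≈⇒Chain (ax e)                =
    subst₂ Chain (sub-id (λ { here → refl }) _) (sub-id (λ { here → refl }) _) (step e (con zero (var here)))
  ≈⇒Chain (≈sub {t' = t'} h p)  = Chain-sub _ (≈⇒Chain p) then Chain-subˢ (λ x → ≈⇒Chain (h x)) t'

  Chain⇒≈ : {t t' : Tm Sg Γ A} → Chain t t' → t ≈[ E ] t'
  Chain⇒≈ (βη p)       = ≈-weaken p
  Chain⇒≈ (step e T)   = inst-cong (λ { zero → ax e ; (suc i) → ≈refl }) T
  Chain⇒≈ (reverse c)  = ≈sym (Chain⇒≈ c)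
  Chain⇒≈ (c then c')  = ≈trans (Chain⇒≈ c) (Chain⇒≈ c')

module Ringoid {S : Set} (Sg : Sig {S}) (E : List (Equation Sg)) where
  private variable
    a b c d : Obj Sg E
    m : ℕ

  infix 4 _≈_
  _≈_ : UExp Sg E a b → UExp Sg E a b → Set
  _≈_ = _≈U_ Sg E

  infix 8 -ᵤ_
  -ᵤ_ : UExp Sg E a b → UExp Sg E a b
  -ᵤ u = (- 1ℚ) •U u

  +-abelianGroup : Obj Sg E → Obj Sg E → AbelianGroup 0ℓ 0ℓ
  +-abelianGroup a b = record
    { Carrier = UExp Sg E a b ; _≈_ = _≈_ ; _∙_ = _+U_ ; ε = zeroU ; _⁻¹ = -ᵤ_
    ; isAbelianGroup = record
      { isGroup = record
        { isMonoid = record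
          { isSemigroup = record
            { isMagma = record
              { isEquivalence = record { refl = ≈Urefl ; sym = ≈Usym ; trans = ≈Utrans }
              ; ∙-cong = +-cong }
            ; assoc = λ _ _ _ → +-assoc }
          ; identity = (λ _ → +-idˡ) , (λ _ → ≈Utrans +-comm +-idˡ) }
        ; inverse = (λ _ → ≈Utrans (+-cong ≈Urefl (≈Usym •-one)) (cancel (- 1ℚ) 1ℚ refl))
                  , (λ _ → ≈Utrans (+-cong (≈Usym •-one) ≈Urefl) (cancel 1ℚ (- 1ℚ) refl))
        ; ⁻¹-cong = •-cong (- 1ℚ) }
      ; comm = λ _ _ → +-comm } }
    where
    cancel : ∀ p q {u : UExp Sg E a b} → p +ℚ q ≡ 0ℚ → p •U u +U q •U u ≈ zeroU
    cancel p q {u} p+q≡0 = ≈Utrans (≈Usym (•-distʳ p q)) (subst (λ r → r •U u ≈ zeroU) (sym p+q≡0) •-zero)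

  module ≈-Reasoning {a b : Obj Sg E} = SetoidReasoning (AbelianGroup.setoid (+-abelianGroup a b))

  module _ {a b : Obj Sg E} where
    open AbelianGroup (+-abelianGroup a b) public using (identityʳ; inverseˡ; inverseʳ)
    open AbelianGroupProperties (+-abelianGroup a b) public using (ε⁻¹≈ε; ⁻¹-∙-comm; ⁻¹-anti-homo‿-)
    open CommutativeSemigroupProperties (AbelianGroup.commutativeSemigroup (+-abelianGroup a b)) public
      using (interchange)

  infixl 6 _-ᵤ_
  _-ᵤ_ : UExp Sg E a b → UExp Sg E a b → UExp Sg E a b
  u -ᵤ v = u +U -ᵤ v

  minus-distrib-+ : {u v w x : UExp Sg E a b} → (u +U v) -ᵤ (w +U x) ≈ (u -ᵤ w) +U (v -ᵤ x)
  minus-distrib-+ {u = u} {v} {w} {x} =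
    ≈Utrans (+-cong ≈Urefl (≈Usym (⁻¹-∙-comm w x))) (interchange u v (-ᵤ w) (-ᵤ x))

  minus-telescope : {u v w : UExp Sg E a b} → (u -ᵤ v) +U (v -ᵤ w) ≈ u -ᵤ w
  minus-telescope {u = u} {v} {w} = begin
    (u +U -ᵤ v) +U (v +U -ᵤ w)  ≈⟨ +-assoc ⟩
    u +U (-ᵤ v +U (v +U -ᵤ w))  ≈⟨ +-cong ≈Urefl (≈Usym +-assoc) ⟩
    u +U ((-ᵤ v +U v) +U -ᵤ w)  ≈⟨ +-cong ≈Urefl (+-cong (inverseˡ v) ≈Urefl) ⟩
    u +U (zeroU +U -ᵤ w)        ≈⟨ +-cong ≈Urefl +-idˡ ⟩
    u +U -ᵤ w                   ∎
    where open ≈-Reasoning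

  ∘-congˡ : {u u' : UExp Sg E b c} {v : UExp Sg E a b} → u ≈ u' → u ∘U v ≈ u' ∘U v
  ∘-congˡ p = ∘-cong p ≈Urefl

  ∘-congʳ : {u : UExp Sg E b c} {v v' : UExp Sg E a b} → v ≈ v' → u ∘U v ≈ u ∘U v'
  ∘-congʳ p = ∘-cong ≈Urefl p

  ∘-zeroˡ : {u : UExp Sg E a b} → zeroU {b = c} ∘U u ≈ zeroU
  ∘-zeroˡ = ≈Utrans (∘-congˡ (≈Usym (•-zero {u = zeroU}))) (≈Utrans (∘-•ˡ 0ℚ) •-zero)

  ∘-zeroʳ : {u : UExp Sg E b c} → u ∘U zeroU {a = a} ≈ zeroU
  ∘-zeroʳ = ≈Utrans (∘-congʳ (≈Usym (•-zero {u = zeroU}))) (≈Utrans (∘-•ʳ 0ℚ) •-zero)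

  ∘-distˡ-minus : {u : UExp Sg E b c} {v w : UExp Sg E a b} → u ∘U (v -ᵤ w) ≈ u ∘U v -ᵤ u ∘U w
  ∘-distˡ-minus = ≈Utrans ∘-distˡ (+-cong ≈Urefl (∘-•ʳ (- 1ℚ)))

  ObjEq-refl : (a : Obj Sg E) → ObjEq Sg E a a
  ObjEq-refl (_ , t) = mk ≈refl

  ObjEq-sym : ObjEq Sg E a b → ObjEq Sg E b a
  ObjEq-sym (mk p) = mk (≈sym p)

  ObjEq-trans : ObjEq Sg E a b → ObjEq Sg E b c → ObjEq Sg E a c
  ObjEq-trans (mk p) (mk q) = mk (≈trans p q)

  cast-cast : (p : ObjEq Sg E b c) (q : ObjEq Sg E c d) (r : ObjEq Sg E b d) {u : UExp Sg E a b} →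
              cast q ∘U (cast p ∘U u) ≈ cast r ∘U u
  cast-cast p q r = ≈Utrans (≈Usym ∘-assoc) (∘-congˡ (cast-∘ p q r))

  cast-cancel : (p : ObjEq Sg E b c) (q : ObjEq Sg E c b) {u : UExp Sg E a b} → cast q ∘U (cast p ∘U u) ≈ u
  cast-cancel {b = b} p q = ≈Utrans (cast-cast p q (ObjEq-refl b)) (≈Utrans (∘-congˡ (cast-id _)) idˡ)

  sumU-cong : {v w : Fin m → UExp Sg E a b} → (∀ j → v j ≈ w j) → sumU Sg E v ≈ sumU Sg E w
  sumU-cong {m = zero}  p = ≈Urefl
  sumU-cong {m = suc m} p = +-cong (p zero) (sumU-cong (λ j → p (suc j)))

  sumU-zero : {v : Fin m → UExp Sg E a b} → (∀ j → v j ≈ zeroU) → sumU Sg E v ≈ zeroU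
  sumU-zero {m = zero}  p = ≈Urefl
  sumU-zero {m = suc m} p = ≈Utrans (+-cong (p zero) (sumU-zero (λ j → p (suc j)))) +-idˡ

  sumU-+ : {v w : Fin m → UExp Sg E a b} → sumU Sg E (λ j → v j +U w j) ≈ sumU Sg E v +U sumU Sg E w
  sumU-+ {m = zero}  = ≈Usym +-idˡ
  sumU-+ {m = suc m} {v = v} {w} =
    ≈Utrans (+-cong ≈Urefl sumU-+) (interchange (v zero) (w zero) _ _)

  ∘-sumU : {u : UExp Sg E b c} {v : Fin m → UExp Sg E a b} → u ∘U sumU Sg E v ≈ sumU Sg E (λ j → u ∘U v j)
  ∘-sumU {m = zero}  = ∘-zeroʳ
  ∘-sumU {m = suc m} = ≈Utrans ∘-distˡ (+-cong ≈Urefl ∘-sumU)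

  sumU-δ : (i : Fin m) {v : Fin m → UExp Sg E a b} → (∀ j → i ≢ j → v j ≈ zeroU) → sumU Sg E v ≈ v i
  sumU-δ zero    off = ≈Utrans (+-cong ≈Urefl (sumU-zero (λ j → off (suc j) λ ()))) (identityʳ _)
  sumU-δ (suc i) off =
    ≈Utrans (+-cong (off zero λ ()) (sumU-δ i (λ j i≢j → off (suc j) λ { refl → i≢j refl }))) +-idˡ

  basis : (F : Fin m → Obj Sg E) (e : Fin m) → UExp Sg E (F e) b → (e' : Fin m) → UExp Sg E (F e') b
  basis F zero    u zero     = u
  basis F zero    u (suc e') = zeroU
  basis F (suc e) u zero     = zeroU
  basis F (suc e) u (suc e') = basis (λ k → F (suc k)) e u e'

  sumU-basis : (F : Fin m → Obj Sg E) (e : Fin m) (u : UExp Sg E (F e) b)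
               (v : (e' : Fin m) → UExp Sg E a (F e')) →
               sumU Sg E (λ e' → basis F e u e' ∘U v e') ≈ u ∘U v e
  sumU-basis F zero    u v = ≈Utrans (+-cong ≈Urefl (sumU-zero (λ _ → ∘-zeroˡ))) (identityʳ _)
  sumU-basis F (suc e) u v =
    ≈Utrans (+-cong ∘-zeroˡ ≈Urefl) (≈Utrans +-idˡ (sumU-basis (λ k → F (suc k)) e u (λ k → v (suc k))))

module Exactness {S : Set} (Sg : Sig {S}) (E : List (Equation Sg)) where
  open Chains Sg E
  open Ringoid Sg E

  private variable
    a b c : Obj Sg E
    A B : Ty S
    m : ℕ

  infix 4 _≈Σ_
  _≈Σ_ : UΣ Sg E b → UΣ Sg E b → Set
  _≈Σ_ = _≈UΣ_ Sg E

  infixr 7 _·_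
  _·_ : UExp Sg E b c → UΣ Sg E b → UΣ Sg E c
  (u · x) i = u ∘U x i

  infixl 6 _+Σ_ _-Σ_
  _+Σ_ : UΣ Sg E b → UΣ Sg E b → UΣ Sg E b
  (x +Σ y) i = x i +U y i

  _-Σ_ : UΣ Sg E b → UΣ Sg E b → UΣ Sg E b
  (x -Σ y) i = x i -ᵤ y i

  0Σ : UΣ Sg E b
  0Σ i = zeroU

  sumΣ : (Fin m → UΣ Sg E b) → UΣ Sg E b
  sumΣ x i = sumU Sg E (λ j → x j i)

  Im-δ₁ : UΣ Sg E b → Set
  Im-δ₁ {b} z = ∃ λ (y : UE Sg E b) → δ₁ Sg E y ≈Σ z

  Im-δ₁-resp : {x y : UΣ Sg E b} → x ≈Σ y → Im-δ₁ x → Im-δ₁ y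
  Im-δ₁-resp x≈y (w , δ₁w≈x) = w , λ i → ≈Utrans (δ₁w≈x i) (x≈y i)

  Im-δ₁-0 : Im-δ₁ {b} 0Σ
  Im-δ₁-0 = (λ _ → zeroU) , λ i → sumU-zero (λ _ → ∘-zeroˡ)

  Im-δ₁-+ : {x y : UΣ Sg E b} → Im-δ₁ x → Im-δ₁ y → Im-δ₁ (x +Σ y)
  Im-δ₁-+ (v , δ₁v≈x) (w , δ₁w≈y) =
    (λ e → v e +U w e) , λ i → ≈Utrans (sumU-cong (λ _ → ∘-distʳ)) (≈Utrans sumU-+ (+-cong (δ₁v≈x i) (δ₁w≈y i)))

  Im-δ₁-· : (u : UExp Sg E b c) {x : UΣ Sg E b} → Im-δ₁ x → Im-δ₁ (u · x)
  Im-δ₁-· u (w , δ₁w≈x) =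
    (λ e → u ∘U w e) , λ i → ≈Utrans (sumU-cong (λ _ → ∘-assoc)) (≈Utrans (≈Usym ∘-sumU) (∘-congʳ (δ₁w≈x i)))

  Im-δ₁-generator : (e : Fin (length E)) → Im-δ₁ (δ₁gen Sg E e)
  Im-δ₁-generator e =
    basis (eobj Sg E) e idU , λ i → ≈Utrans (sumU-basis (eobj Sg E) e idU (λ e' → δ₁gen Sg E e' i)) idˡ

  infix 4 _∼_
  _∼_ : UΣ Sg E b → UΣ Sg E b → Set
  x ∼ y = Im-δ₁ (x -Σ y)

  ∼-reflexive : {x y : UΣ Sg E b} → x ≈Σ y → x ∼ y
  ∼-reflexive x≈y = Im-δ₁-resp (λ i → ≈Usym (≈Utrans (+-cong (x≈y i) ≈Urefl) (inverseʳ _))) Im-δ₁-0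

  ∼-sym : {x y : UΣ Sg E b} → x ∼ y → y ∼ x
  ∼-sym x∼y = Im-δ₁-resp (λ i → ≈Utrans (∘-•ˡ (- 1ℚ)) (≈Utrans (•-cong (- 1ℚ) idˡ) (⁻¹-anti-homo‿- _ _)))
                         (Im-δ₁-· (-ᵤ idU) x∼y)

  ∼-trans : {x y z : UΣ Sg E b} → x ∼ y → y ∼ z → x ∼ z
  ∼-trans x∼y y∼z = Im-δ₁-resp (λ i → minus-telescope) (Im-δ₁-+ x∼y y∼z)

  ∼-· : (u : UExp Sg E b c) {x y : UΣ Sg E b} → x ∼ y → u · x ∼ u · y
  ∼-· u x∼y = Im-δ₁-resp (λ i → ∘-distˡ-minus) (Im-δ₁-· u x∼y)

  ∼-+ : {x x' y y' : UΣ Sg E b} → x ∼ x' → y ∼ y' → x +Σ y ∼ x' +Σ y'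
  ∼-+ x∼x' y∼y' = Im-δ₁-resp (λ i → ≈Usym minus-distrib-+) (Im-δ₁-+ x∼x' y∼y')

  ∼-sumΣ : {x y : Fin m → UΣ Sg E b} → (∀ j → x j ∼ y j) → sumΣ x ∼ sumΣ y
  ∼-sumΣ {m = zero}  _   = ∼-reflexive (λ _ → ≈Urefl)
  ∼-sumΣ {m = suc m} x∼y = ∼-+ (x∼y zero) (∼-sumΣ (λ j → x∼y (suc j)))

  ∼-cast-flip : {x : UΣ Sg E b} {y : UΣ Sg E a} (p : ObjEq Sg E a b) (q : ObjEq Sg E b a) →
                x ∼ cast p · y → y ∼ cast q · x
  ∼-cast-flip p q x∼py = ∼-sym (∼-trans (∼-· (cast q) x∼py) (∼-reflexive (λ i → cast-cancel p q)))

  ∼-cast-trans : {x : UΣ Sg E c} {y : UΣ Sg E b} {z : UΣ Sg E a}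
                 (p : ObjEq Sg E a b) (q : ObjEq Sg E b c) (r : ObjEq Sg E a c) →
                 x ∼ cast q · y → y ∼ cast p · z → x ∼ cast r · z
  ∼-cast-trans p q r x∼qy y∼pz = ∼-trans x∼qy (∼-trans (∼-· (cast q) y∼pz) (∼-reflexive (λ i → cast-cast p q r)))

  cast-gen : (ω : Op) {f f' : Args Sg E (ar ω)} (h : ∀ j → f j ≈[ E ] f' j) (j : Fin (length (ar ω)))
             (p : ObjEq Sg E (obj Sg E (apply Sg E ω f)) (obj Sg E (apply Sg E ω f')))
             {u : UExp Sg E a (obj Sg E (f j))} →
             cast p ∘U (gen ω j f ∘U u) ≈ gen ω j f' ∘U (cast (mk (h j)) ∘U u)
  cast-gen ω {f} {f'} h j p =
    ≈Utrans (≈Usym ∘-assoc) (≈Utrans (∘-congˡ (gen-resp (body ω) (body ω) ≈refl f f' h j (mk (h j)) p)) ∘-assoc)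

  φ₀-chain-rule : (ω : Op) (f : Args Sg E (ar ω)) →
                  φ₀ Sg E (apply Sg E ω f) ≈Σ sumΣ (λ j → gen ω j f · φ₀ Sg E (f j))
  φ₀-chain-rule ω f i = begin
    cast (mk (inst-c̃ Sg E (apply Sg E ω f))) ∘U gen (op Sg E (apply Sg E ω f)) i c̃'
      ≈⟨ ∘-congʳ (chain ω Sg f c̃' i p) ⟩
    cast (mk (inst-c̃ Sg E (apply Sg E ω f))) ∘U (cast p ∘U sumU Sg E (λ j → gen ω j g ∘U D j))
      ≈⟨ cast-cast p _ q ⟩
    cast q ∘U sumU Sg E (λ j → gen ω j g ∘U D j)
      ≈⟨ ∘-sumU ⟩
    sumU Sg E (λ j → cast q ∘U (gen ω j g ∘U D j))
      ≈⟨ sumU-cong (λ j → cast-gen ω g≈f j q) ⟩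
    sumU Sg E (λ j → gen ω j f ∘U φ₀ Sg E (f j) i) ∎
    where
    open ≈-Reasoning
    c̃' = c̃ Sg E
    g : Args Sg E (ar ω)
    g j = inst c̃' (f j)
    g≈f : ∀ j → g j ≈[ E ] f j
    g≈f j = inst-c̃ Sg E (f j)
    D : ∀ j → UExp Sg E _ _
    D j = gen (op Sg E (f j)) i c̃'
    p = mk (≈trans (inst-cong g≈f (body ω)) (≈sym (inst-c̃ Sg E _)))
    q = mk (inst-cong g≈f (body ω))

  φ₀-apply-cong : (ω : Op) {f f' : Args Sg E (ar ω)} (h : ∀ j → f j ≈[ E ] f' j) →
                  (∀ j → φ₀ Sg E (f' j) ∼ cast (mk (h j)) · φ₀ Sg E (f j)) →
                  (p : ObjEq Sg E (obj Sg E (apply Sg E ω f)) (obj Sg E (apply Sg E ω f'))) →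
                  φ₀ Sg E (apply Sg E ω f') ∼ cast p · φ₀ Sg E (apply Sg E ω f)
  φ₀-apply-cong ω {f} {f'} h φ₀f'∼φ₀f p =
    ∼-trans (∼-reflexive (φ₀-chain-rule ω f'))
            (∼-trans (∼-sumΣ (λ j → ∼-· (gen ω j f') (φ₀f'∼φ₀f j))) (∼-reflexive (λ i → ≈Usym (transported i))))
    where
    transported : cast p · φ₀ Sg E (apply Sg E ω f) ≈Σ sumΣ (λ j → gen ω j f' · cast (mk (h j)) · φ₀ Sg E (f j))
    transported i = ≈Utrans (∘-congʳ (φ₀-chain-rule ω f i)) (≈Utrans ∘-sumU (sumU-cong (λ j → cast-gen ω h j p)))

  φ₀-resp-βη : {t t' : Tm Sg (A ∷ []) B} → t ≈[ [] ] t' → (p : ObjEq Sg E (obj Sg E t) (obj Sg E t')) →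
               φ₀ Sg E t' ≈Σ cast p · φ₀ Sg E t
  φ₀-resp-βη {t = t} {t'} t≈t' p i = begin
    cast (mk (inst-c̃ Sg E t')) ∘U gen (op Sg E t') i c̃'
      ≈⟨ ∘-congʳ (≈Usym (≈Utrans (∘-congʳ (cast-id _)) idʳ)) ⟩
    cast (mk (inst-c̃ Sg E t')) ∘U (gen (op Sg E t') i c̃' ∘U cast (mk ≈refl))
      ≈⟨ ∘-congʳ (≈Usym (gen-resp t t' t≈t' c̃' c̃' (λ _ → ≈refl) i (mk ≈refl) q)) ⟩
    cast (mk (inst-c̃ Sg E t')) ∘U (cast q ∘U gen (op Sg E t) i c̃')
      ≈⟨ cast-cast q _ r ⟩
    cast r ∘U gen (op Sg E t) i c̃'
      ≈⟨ ≈Usym (cast-cast _ p r) ⟩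
    cast p ∘U (cast (mk (inst-c̃ Sg E t)) ∘U gen (op Sg E t) i c̃') ∎
    where
    open ≈-Reasoning
    c̃' = c̃ Sg E
    q = mk (≈trans (inst-c̃ Sg E t) (≈trans (≈-weaken t≈t') (≈sym (inst-c̃ Sg E t'))))
    r = ObjEq-trans (mk (inst-c̃ Sg E t)) p

  φ₀-resp-Chain : {t t' : Tm Sg (A ∷ []) B} → Chain t t' → (p : ObjEq Sg E (obj Sg E t) (obj Sg E t')) →
                  φ₀ Sg E t' ∼ cast p · φ₀ Sg E t
  φ₀-resp-Chain (βη t≈t') p  = ∼-reflexive (φ₀-resp-βη t≈t' p)
  φ₀-resp-Chain (step e T) p = φ₀-apply-cong (mkOp (eqSym e ∷ Sg) _ _ T) fill-≈ φ₀-fill p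
    where
    fill-≈ : ∀ j → fill (lhs (lookup E e)) j ≈[ E ] fill (rhs (lookup E e)) j
    fill-≈ zero    = ax e
    fill-≈ (suc k) = ≈refl
    φ₀-fill : ∀ j → φ₀ Sg E (fill (rhs (lookup E e)) j)
                    ∼ cast (mk (fill-≈ j)) · φ₀ Sg E (fill (lhs (lookup E e)) j)
    -- δ₁gen e is by definition φ₀ l -Σ cast · φ₀ r, so it is a proof of φ₀ l ∼ cast · φ₀ r.
    φ₀-fill zero    = ∼-cast-flip _ _ (Im-δ₁-generator e)
    φ₀-fill (suc k) = ∼-reflexive (λ i → ≈Usym (≈Utrans (∘-congˡ (cast-id _)) idˡ))
  φ₀-resp-Chain (reverse c) p = ∼-cast-flip _ p (φ₀-resp-Chain c (ObjEq-sym p))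
  φ₀-resp-Chain (c then c') p =
    ∼-cast-trans q q' p (φ₀-resp-Chain c' q') (φ₀-resp-Chain c q)
    where
    q  = mk (Chain⇒≈ c)
    q' = mk (Chain⇒≈ c')

  φ₀-resp-≈ : {t t' : Tm Sg (A ∷ []) B} (t≈t' : t ≈[ E ] t') → φ₀ Sg E t' ∼ cast (mk t≈t') · φ₀ Sg E t
  φ₀-resp-≈ t≈t' = φ₀-resp-Chain (≈⇒Chain t≈t') (mk t≈t')

  infix 4 _≈Ω'_
  _≈Ω'_ : ΩExp Sg E b → ΩExp Sg E b → Set
  _≈Ω'_ = _≈Ω_ Sg E

  +Ω-commutativeMonoid : Obj Sg E → CommutativeMonoid 0ℓ 0ℓ
  +Ω-commutativeMonoid b = record
    { Carrier = ΩExp Sg E b ; _≈_ = _≈Ω'_ ; _∙_ = _+Ω_ ; ε = zeroΩ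
    ; isCommutativeMonoid = record
      { isMonoid = record
        { isSemigroup = record
          { isMagma = record
            { isEquivalence = record { refl = ≈Ωrefl ; sym = ≈Ωsym ; trans = ≈Ωtrans }
            ; ∙-cong = +Ω-cong }
          ; assoc = λ _ _ _ → +Ω-assoc }
        ; identity = (λ _ → +Ω-idˡ) , (λ _ → ≈Ωtrans +Ω-comm +Ω-idˡ) }
      ; comm = λ _ _ → +Ω-comm } }

  module ≈Ω-Reasoning {b : Obj Sg E} = SetoidReasoning (CommutativeMonoid.setoid (+Ω-commutativeMonoid b))

  sumΩ-cong : {x y : Fin m → ΩExp Sg E b} → (∀ j → x j ≈Ω' y j) → sumΩ Sg E x ≈Ω' sumΩ Sg E y
  sumΩ-cong {m = zero}  _   = ≈Ωrefl
  sumΩ-cong {m = suc m} x≈y = +Ω-cong (x≈y zero) (sumΩ-cong (λ j → x≈y (suc j)))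

  sumΩ-zero : {x : Fin m → ΩExp Sg E b} → (∀ j → x j ≈Ω' zeroΩ) → sumΩ Sg E x ≈Ω' zeroΩ
  sumΩ-zero {m = zero}  _   = ≈Ωrefl
  sumΩ-zero {m = suc m} x≈0 = ≈Ωtrans (+Ω-cong (x≈0 zero) (sumΩ-zero (λ j → x≈0 (suc j)))) +Ω-idˡ

  sumΩ-+ : {x y : Fin m → ΩExp Sg E b} → sumΩ Sg E (λ j → x j +Ω y j) ≈Ω' sumΩ Sg E x +Ω sumΩ Sg E y
  sumΩ-+ {m = zero}           = ≈Ωsym +Ω-idˡ
  sumΩ-+ {m = suc m} {b} {x} {y} =
    ≈Ωtrans (+Ω-cong ≈Ωrefl sumΩ-+)
            (CommutativeSemigroupProperties.interchange
              (CommutativeMonoid.commutativeSemigroup (+Ω-commutativeMonoid b)) (x zero) (y zero) _ _)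

  sumΩ-act : {u : UExp Sg E b c} {x : Fin m → ΩExp Sg E b} →
             sumΩ Sg E (λ j → actΩ u (x j)) ≈Ω' actΩ u (sumΩ Sg E x)
  sumΩ-act {m = zero}  = ≈Ωsym act-zeroΩ
  sumΩ-act {m = suc m} = ≈Ωtrans (+Ω-cong ≈Ωrefl sumΩ-act) (≈Ωsym act-+Ω)

  private
    ε' : UΣ Sg E b → ΩExp Sg E b
    ε' = ε Sg E

  ε-cong : {x y : UΣ Sg E b} → x ≈Σ y → ε' x ≈Ω' ε' y
  ε-cong x≈y = sumΩ-cong (λ i → act-cong (x≈y i) ≈Ωrefl)

  ε-+ : (x y : UΣ Sg E b) → ε' (x +Σ y) ≈Ω' ε' x +Ω ε' y
  ε-+ x y = ≈Ωtrans (sumΩ-cong (λ i → act-+U)) sumΩ-+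

  ε-· : (u : UExp Sg E b c) (x : UΣ Sg E b) → ε' (u · x) ≈Ω' actΩ u (ε' x)
  ε-· u x = ≈Ωtrans (sumΩ-cong (λ i → act-∘)) sumΩ-act

  ε-sumΣ : (x : Fin m → UΣ Sg E b) → ε' (sumΣ x) ≈Ω' sumΩ Sg E (λ j → ε' (x j))
  ε-sumΣ {m = zero}  x = sumΩ-zero (λ i → act-zeroU)
  ε-sumΣ {m = suc m} x = ≈Ωtrans (ε-+ (x zero) _) (+Ω-cong ≈Ωrefl (ε-sumΣ (λ j → x (suc j))))

  ε-φ₀ : (t : Tm Sg (A ∷ []) B) → ε' (φ₀ Sg E t) ≈Ω' dΩ (obj Sg E t)
  ε-φ₀ t = begin
    ε' (cast p · λ i → gen (op Sg E t) i (c̃ Sg E))     ≈⟨ ε-· (cast p) _ ⟩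
    actΩ (cast p) (ε' λ i → gen (op Sg E t) i (c̃ Sg E))
                                                        ≈⟨ act-cong ≈Urefl (≈Ωsym (d-op (op Sg E t) (c̃ Sg E))) ⟩
    actΩ (cast p) (dΩ (obj Sg E (inst (c̃ Sg E) t)))     ≈⟨ ≈Ωsym (d-cast p) ⟩
    dΩ (obj Sg E t)                                     ∎
    where
    open ≈Ω-Reasoning
    p = mk (inst-c̃ Sg E t)

  ε-δ₁gen : (e : Fin (length E)) → ε' (δ₁gen Sg E e) ≈Ω' zeroΩ
  ε-δ₁gen e = begin
    ε' (δ₁gen Sg E e)
      ≈⟨ ε-cong (λ i → +-cong ≈Urefl (≈Usym (N-· i))) ⟩
    ε' (φ₀ Sg E l +Σ N · φ₀ Sg E r)
      ≈⟨ ε-+ _ _ ⟩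
    ε' (φ₀ Sg E l) +Ω ε' (N · φ₀ Sg E r)
      ≈⟨ +Ω-cong (ε-φ₀ l) (ε-· N _) ⟩
    dΩ (obj Sg E l) +Ω actΩ N (ε' (φ₀ Sg E r))
      ≈⟨ +Ω-cong (≈Ωsym act-id) (≈Ωtrans (act-cong ≈Urefl (ε-φ₀ r)) act-∘) ⟩
    actΩ idU (dΩ (obj Sg E l)) +Ω actΩ (-ᵤ idU) (actΩ (cast s) (dΩ (obj Sg E r)))
      ≈⟨ +Ω-cong ≈Ωrefl (act-cong ≈Urefl (≈Ωsym (d-cast s))) ⟩
    actΩ idU (dΩ (obj Sg E l)) +Ω actΩ (-ᵤ idU) (dΩ (obj Sg E l))
      ≈⟨ ≈Ωsym act-+U ⟩
    actΩ (idU +U -ᵤ idU) (dΩ (obj Sg E l))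
      ≈⟨ act-cong (inverseʳ idU) ≈Ωrefl ⟩
    actΩ zeroU (dΩ (obj Sg E l))
      ≈⟨ act-zeroU ⟩
    zeroΩ ∎
    where
    open ≈Ω-Reasoning
    l = lhs (lookup E e)
    r = rhs (lookup E e)
    s = mk (≈sym (ax e))
    N = (-ᵤ idU) ∘U cast s
    N-· : ∀ i → (N · φ₀ Sg E r) i ≈ -ᵤ (cast s ∘U φ₀ Sg E r i)
    N-· i = ≈Utrans ∘-assoc (≈Utrans (∘-•ˡ (- 1ℚ)) (•-cong (- 1ℚ) idˡ))

  ε-δ₁ : (y : UE Sg E b) → ε' (δ₁ Sg E y) ≈Ω' zeroΩ
  ε-δ₁ y = ≈Ωtrans (ε-sumΣ (λ e → y e · δ₁gen Sg E e))
                   (sumΩ-zero (λ e → ≈Ωtrans (ε-· (y e) _) (≈Ωtrans (act-cong ≈Urefl (ε-δ₁gen e)) act-zeroΩ)))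

  φ : ΩExp Sg E b → UΣ Sg E b
  φ (dΩ (_ , t)) = φ₀ Sg E t
  φ (actΩ u x)   = u · φ x
  φ zeroΩ        = 0Σ
  φ (x +Ω y)     = φ x +Σ φ y

  φ-sumΩ : (x : Fin m → ΩExp Sg E b) → φ (sumΩ Sg E x) ≈Σ sumΣ (λ j → φ (x j))
  φ-sumΩ {m = zero}  x i = ≈Urefl
  φ-sumΩ {m = suc m} x i = +-cong ≈Urefl (φ-sumΩ (λ j → x (suc j)) i)

  φ-resp : {x y : ΩExp Sg E b} → x ≈Ω' y → φ x ∼ φ y
  φ-resp ≈Ωrefl              = ∼-reflexive (λ _ → ≈Urefl)
  φ-resp (≈Ωsym x≈y)         = ∼-sym (φ-resp x≈y)
  φ-resp (≈Ωtrans x≈y y≈z)   = ∼-trans (φ-resp x≈y) (φ-resp y≈z)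
  φ-resp (act-cong {u' = u'} u≈u' x≈x') =
    ∼-trans (∼-reflexive (λ i → ∘-congˡ u≈u')) (∼-· u' (φ-resp x≈x'))
  φ-resp (+Ω-cong x≈x' y≈y') = ∼-+ (φ-resp x≈x') (φ-resp y≈y')
  φ-resp +Ω-assoc            = ∼-reflexive (λ _ → +-assoc)
  φ-resp +Ω-comm             = ∼-reflexive (λ _ → +-comm)
  φ-resp +Ω-idˡ              = ∼-reflexive (λ _ → +-idˡ)
  φ-resp act-id              = ∼-reflexive (λ _ → idˡ)
  φ-resp act-∘               = ∼-reflexive (λ _ → ∘-assoc)
  φ-resp act-+U              = ∼-reflexive (λ _ → ∘-distʳ)
  φ-resp act-zeroU           = ∼-reflexive (λ _ → ∘-zeroˡ)
  φ-resp act-+Ω              = ∼-reflexive (λ _ → ∘-distˡ)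
  φ-resp act-zeroΩ           = ∼-reflexive (λ _ → ∘-zeroʳ)
  φ-resp (d-cast (mk t≈t'))  = φ₀-resp-≈ t≈t'
  φ-resp (d-op ω f)          = ∼-reflexive (λ i → ≈Utrans (φ₀-chain-rule ω f i) (≈Usym (φ-sumΩ _ i)))

  φ₀-c̃-diag : (i : Fin (length Sg)) → φ₀ Sg E (c̃ Sg E i) i ≈ idU
  φ₀-c̃-diag i = ≈Utrans (∘-congʳ (ι-diag Sg i (c̃ Sg E) (mk ≈refl))) (≈Utrans (cast-∘ _ _ (mk ≈refl)) (cast-id _))

  φ₀-c̃-off : (i j : Fin (length Sg)) → i ≢ j → φ₀ Sg E (c̃ Sg E j) i ≈ zeroU
  φ₀-c̃-off i j i≢j = ≈Utrans (∘-congʳ (ι-off Sg j i (c̃ Sg E) (λ j≡i → i≢j (sym j≡i)))) ∘-zeroʳ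

  φ-ε : (x : UΣ Sg E b) → φ (ε' x) ≈Σ x
  φ-ε x i = ≈Utrans (φ-sumΩ _ i) (≈Utrans (sumU-δ i off) (≈Utrans (∘-congʳ (φ₀-c̃-diag i)) idʳ))
    where
    off : ∀ j → i ≢ j → x j ∘U φ₀ Sg E (c̃ Sg E j) i ≈ zeroU
    off j i≢j = ≈Utrans (∘-congʳ (φ₀-c̃-off i j i≢j)) ∘-zeroʳ

  ker-ε⇔Im-δ₁ : (x : UΣ Sg E b) → ε' x ≈Ω' zeroΩ ⇔ Im-δ₁ x
  ker-ε⇔Im-δ₁ x = mk⇔
    (λ εx≈0 → Im-δ₁-resp φεx-0≈x (φ-resp εx≈0))
    (λ (y , δ₁y≈x) → ≈Ωtrans (ε-cong (λ i → ≈Usym (δ₁y≈x i))) (ε-δ₁ y))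
    where
    φεx-0≈x : φ (ε' x) -Σ 0Σ ≈Σ x
    φεx-0≈x i = ≈Utrans (+-cong ≈Urefl ε⁻¹≈ε) (≈Utrans (identityʳ _) (φ-ε x i))

mainTheorem9 : {S : Set} (Σ₀ : List (Ty S × S)) (E : List (Equation (sigOf Σ₀))) →
    (∀ (e : Fin (length E)) → occ (lhs (lookup E e)) 0 ≡ occ (rhs (lookup E e)) 0) →
    ∀ (b : Obj (sigOf Σ₀) E) (x : UΣ (sigOf Σ₀) E b) →
    _≈Ω_ (sigOf Σ₀) E (ε (sigOf Σ₀) E x) zeroΩ
      ⇔ ∃ (λ (y : UE (sigOf Σ₀) E b) → _≈UΣ_ (sigOf Σ₀) E (δ₁ (sigOf Σ₀) E y) x)
mainTheorem9 Σ₀ E _ b x = Exactness.ker-ε⇔Im-δ₁ (sigOf Σ₀) E x
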